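{- For any position $G$: (1) $G \in \mathcal{L}$ if and only if $G + *R \in \mathcal{R}$; (2) $G \in \mathcal{R}$ if and only if $G + *R \in \mathcal{L}$; (3) $G \in \mathcal{P}$ if and only if $G + *R \in \mathcal{P}$; (4) $G \in \mathcal{N}$ if and only if $G + *R \in \mathcal{N}$.
   Context: Positions are defined recursively: $*L$ and $*R$ are terminal positions; if $G_1,\dots,G_n$ ($n\ge 1$) are positions, then $\{G_1,\dots,G_n\}$ is a position with options $G_1,\dots,G_n$. All positions have finite game trees. Play: Left and Right move alternately, each choosing any option of the current position (both players have the same options); when a terminal position is reached, Left wins if it is $*L$ and Right wins if it is $*R$. Disjunctive sum: $*L + *L = *R + *R = *L$, $*L + *R = *R + *L = *R$; if at least one of $G,H$ is non-terminal, $G+H$ is the position whose options are all $G'+H$ ($G'$ an option of $G$) and all $G+H'$ ($H'$ an option of $H$), a terminal summand contributing no options. Outcome classes: $\mathcal{L}$ (Left wins moving first or second), $\mathcal{R}$ (Right wins moving first or second), $\mathcal{N}$ (the first player wins), $\mathcal{P}$ (the second player wins). -}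

module Defs where

open import Data.List using (List; []; _∷_; map; _++_)
open import Data.List.Relation.Unary.Any using (Any)
open import Data.List.Relation.Unary.All using (All)
open import Data.Product using (_×_)

-- Positions: the terminal positions *L, *R, and {G₁,…,Gₙ} with n ≥ 1
-- (the options are given as a head option plus a list of further options).
data Pos : Set where
  *L : Pos
  *R : Pos
  ⟨_∣_⟩ : Pos → List Pos → Pos

opts : Pos → List Pos
opts *L = []
opts *R = []
opts ⟨ g ∣ gs ⟩ = g ∷ gs

mutual
  _⊕_ : Pos → Pos → Pos
  *L ⊕ *L = *L
  *R ⊕ *R = *L
  *L ⊕ *R = *R
  *R ⊕ *L = *R
  *L ⊕ ⟨ h ∣ hs ⟩ = ⟨ *L ⊕ h ∣ mapL *L hs ⟩
  *R ⊕ ⟨ h ∣ hs ⟩ = ⟨ *R ⊕ h ∣ mapL *R hs ⟩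
  ⟨ g ∣ gs ⟩ ⊕ *L = ⟨ g ⊕ *L ∣ mapR gs *L ⟩
  ⟨ g ∣ gs ⟩ ⊕ *R = ⟨ g ⊕ *R ∣ mapR gs *R ⟩
  ⟨ g ∣ gs ⟩ ⊕ ⟨ h ∣ hs ⟩ =
    ⟨ g ⊕ ⟨ h ∣ hs ⟩ ∣ mapR gs ⟨ h ∣ hs ⟩ ++ (⟨ g ∣ gs ⟩ ⊕ h) ∷ mapL ⟨ g ∣ gs ⟩ hs ⟩

  mapL : Pos → List Pos → List Pos
  mapL G [] = []
  mapL G (h ∷ hs) = (G ⊕ h) ∷ mapL G hs

  mapR : List Pos → Pos → List Pos
  mapR [] H = []
  mapR (g ∷ gs) H = (g ⊕ H) ∷ mapR gs H

infixl 6 _⊕_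

-- Winning conditions (both players have the same options).
mutual
  data LeftWinsFirst : Pos → Set where
    lf-term : LeftWinsFirst *L
    lf-move : ∀ {g gs} → Any LeftWinsSecond (g ∷ gs) → LeftWinsFirst ⟨ g ∣ gs ⟩

  data LeftWinsSecond : Pos → Set where
    ls-term : LeftWinsSecond *L
    ls-move : ∀ {g gs} → All LeftWinsFirst (g ∷ gs) → LeftWinsSecond ⟨ g ∣ gs ⟩

mutual
  data RightWinsFirst : Pos → Set where
    rf-term : RightWinsFirst *R
    rf-move : ∀ {g gs} → Any RightWinsSecond (g ∷ gs) → RightWinsFirst ⟨ g ∣ gs ⟩

  data RightWinsSecond : Pos → Set where
    rs-term : RightWinsSecond *R
    rs-move : ∀ {g gs} → All RightWinsFirst (g ∷ gs) → RightWinsSecond ⟨ g ∣ gs ⟩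

data Outcome : Set where
  𝓛 𝓡 𝓝 𝓟 : Outcome

_∈ₒ_ : Pos → Outcome → Set
G ∈ₒ 𝓛 = LeftWinsFirst G × LeftWinsSecond G
G ∈ₒ 𝓡 = RightWinsFirst G × RightWinsSecond G
G ∈ₒ 𝓝 = LeftWinsFirst G × RightWinsFirst G
G ∈ₒ 𝓟 = LeftWinsSecond G × RightWinsSecond G

infix 4 _∈ₒ_

-- Adding *R changes nothing but the terminal positions: every terminal *L becomes *R
-- and vice versa, while the game tree is untouched.  Hence a winning strategy for one
-- player in G is a winning strategy for the other in G + *R; and since *R + *R = *L,
-- adding *R twice gives G back, which yields the converses.
module Submission where

open import Defs
open import Data.Product using (_×_; _,_)
open import Function.Bundles using (_⇔_; mk⇔)
open import Data.List using (List; []; _∷_)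
open import Data.List.Relation.Unary.Any using (Any; here; there)
open import Data.List.Relation.Unary.All using (All; []; _∷_)
open import Relation.Binary.PropositionalEquality using (_≡_; refl; cong₂; subst₂)

mutual
  ⊕*R-involutive : ∀ G → G ⊕ *R ⊕ *R ≡ G
  ⊕*R-involutive *L = refl
  ⊕*R-involutive *R = refl
  ⊕*R-involutive ⟨ g ∣ gs ⟩ = cong₂ ⟨_∣_⟩ (⊕*R-involutive g) (mapR-*R-involutive gs)

  mapR-*R-involutive : ∀ gs → mapR (mapR gs *R) *R ≡ gs
  mapR-*R-involutive [] = refl
  mapR-*R-involutive (g ∷ gs) = cong₂ _∷_ (⊕*R-involutive g) (mapR-*R-involutive gs)

mutual
  leftFirst⇒rightFirst-⊕*R : ∀ {G} → LeftWinsFirst G → RightWinsFirst (G ⊕ *R)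
  leftFirst⇒rightFirst-⊕*R lf-term = rf-term
  leftFirst⇒rightFirst-⊕*R (lf-move wins) = rf-move (any-leftSecond⇒rightSecond-⊕*R wins)

  leftSecond⇒rightSecond-⊕*R : ∀ {G} → LeftWinsSecond G → RightWinsSecond (G ⊕ *R)
  leftSecond⇒rightSecond-⊕*R ls-term = rs-term
  leftSecond⇒rightSecond-⊕*R (ls-move wins) = rs-move (all-leftFirst⇒rightFirst-⊕*R wins)

  rightFirst⇒leftFirst-⊕*R : ∀ {G} → RightWinsFirst G → LeftWinsFirst (G ⊕ *R)
  rightFirst⇒leftFirst-⊕*R rf-term = lf-term
  rightFirst⇒leftFirst-⊕*R (rf-move wins) = lf-move (any-rightSecond⇒leftSecond-⊕*R wins)

  rightSecond⇒leftSecond-⊕*R : ∀ {G} → RightWinsSecond G → LeftWinsSecond (G ⊕ *R)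
  rightSecond⇒leftSecond-⊕*R rs-term = ls-term
  rightSecond⇒leftSecond-⊕*R (rs-move wins) = ls-move (all-rightFirst⇒leftFirst-⊕*R wins)

  any-leftSecond⇒rightSecond-⊕*R : ∀ {gs} →
    Any LeftWinsSecond gs → Any RightWinsSecond (mapR gs *R)
  any-leftSecond⇒rightSecond-⊕*R (here w) = here (leftSecond⇒rightSecond-⊕*R w)
  any-leftSecond⇒rightSecond-⊕*R (there ws) = there (any-leftSecond⇒rightSecond-⊕*R ws)

  any-rightSecond⇒leftSecond-⊕*R : ∀ {gs} →
    Any RightWinsSecond gs → Any LeftWinsSecond (mapR gs *R)
  any-rightSecond⇒leftSecond-⊕*R (here w) = here (rightSecond⇒leftSecond-⊕*R w)
  any-rightSecond⇒leftSecond-⊕*R (there ws) = there (any-rightSecond⇒leftSecond-⊕*R ws)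

  all-leftFirst⇒rightFirst-⊕*R : ∀ {gs} →
    All LeftWinsFirst gs → All RightWinsFirst (mapR gs *R)
  all-leftFirst⇒rightFirst-⊕*R [] = []
  all-leftFirst⇒rightFirst-⊕*R (w ∷ ws) =
    leftFirst⇒rightFirst-⊕*R w ∷ all-leftFirst⇒rightFirst-⊕*R ws

  all-rightFirst⇒leftFirst-⊕*R : ∀ {gs} →
    All RightWinsFirst gs → All LeftWinsFirst (mapR gs *R)
  all-rightFirst⇒leftFirst-⊕*R [] = []
  all-rightFirst⇒leftFirst-⊕*R (w ∷ ws) =
    rightFirst⇒leftFirst-⊕*R w ∷ all-rightFirst⇒leftFirst-⊕*R ws

mirror : Outcome → Outcome
mirror 𝓛 = 𝓡
mirror 𝓡 = 𝓛
mirror 𝓝 = 𝓝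
mirror 𝓟 = 𝓟

∈ₒ⇒⊕*R∈ₒmirror : ∀ {G} o → G ∈ₒ o → G ⊕ *R ∈ₒ mirror o
∈ₒ⇒⊕*R∈ₒmirror 𝓛 (f , s) = leftFirst⇒rightFirst-⊕*R f , leftSecond⇒rightSecond-⊕*R s
∈ₒ⇒⊕*R∈ₒmirror 𝓡 (f , s) = rightFirst⇒leftFirst-⊕*R f , rightSecond⇒leftSecond-⊕*R s
∈ₒ⇒⊕*R∈ₒmirror 𝓝 (l , r) = rightFirst⇒leftFirst-⊕*R r , leftFirst⇒rightFirst-⊕*R l
∈ₒ⇒⊕*R∈ₒmirror 𝓟 (l , r) = rightSecond⇒leftSecond-⊕*R r , leftSecond⇒rightSecond-⊕*R l

mirror-involutive : ∀ o → mirror (mirror o) ≡ o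
mirror-involutive 𝓛 = refl
mirror-involutive 𝓡 = refl
mirror-involutive 𝓝 = refl
mirror-involutive 𝓟 = refl

∈ₒ⇔⊕*R∈ₒmirror : ∀ G o → G ∈ₒ o ⇔ G ⊕ *R ∈ₒ mirror o
∈ₒ⇔⊕*R∈ₒmirror G o = mk⇔ (∈ₒ⇒⊕*R∈ₒmirror o) from
  where
  from : G ⊕ *R ∈ₒ mirror o → G ∈ₒ o
  from h = subst₂ _∈ₒ_ (⊕*R-involutive G) (mirror-involutive o)
                  (∈ₒ⇒⊕*R∈ₒmirror (mirror o) h)

proposition2p9 : (G : Pos) →
    (G ∈ₒ 𝓛 ⇔ G ⊕ *R ∈ₒ 𝓡) × (G ∈ₒ 𝓡 ⇔ G ⊕ *R ∈ₒ 𝓛)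
      × (G ∈ₒ 𝓟 ⇔ G ⊕ *R ∈ₒ 𝓟) × (G ∈ₒ 𝓝 ⇔ G ⊕ *R ∈ₒ 𝓝)
proposition2p9 G =
  ∈ₒ⇔⊕*R∈ₒmirror G 𝓛 , ∈ₒ⇔⊕*R∈ₒmirror G 𝓡 , ∈ₒ⇔⊕*R∈ₒmirror G 𝓟 , ∈ₒ⇔⊕*R∈ₒmirror G 𝓝
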